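{- For every dealing pattern $P$: $F^{DP}(1)=1$ and $F^{DP}(N)=F^{P}(N-1)+1$ for $N>1$; and for every $N\ge1$, $F^{UP}(N)\equiv 1+F^{P}(N)\pmod N$.
   Context: A dealing pattern $P=P_1P_2P_3\cdots$ is an infinite sequence of letters $U$ and $D$ containing infinitely many $D$'s. Dealing a deck of $N$ cards (positions $1,\dots,N$ from the top) by $P$ means: process the letters in order; for a $U$ move the top card to the bottom; for a $D$ remove the top card (deal it); stop when all $N$ cards are dealt. $F^P(N)$ is the initial position of the last card dealt. $DP$ (resp. $UP$) denotes the pattern obtained by prepending $D$ (resp. $U$) to $P$. -}

module Defs where

open import Data.Nat using (ℕ; zero; suc; _∸_; _≤_; z≤n; s≤s)
open import Data.Nat.Properties using (≤-refl; m≤n⇒m≤1+n)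
open import Data.Fin using (toℕ)
open import Data.Product using (∃; _,_; _×_)
open import Data.Vec using (Vec; []; _∷_; _∷ʳ_; tail; tabulate)
open import Relation.Binary.PropositionalEquality using (_≡_; refl)

data Letter : Set where
  U D : Letter

-- A dealing pattern: an infinite sequence P₀P₁P₂… of letters (index 0 is the
-- first letter) with infinitely many D's.
record Pattern : Set where
  field
    seq  : ℕ → Letter
    infD : ∀ n → ∃ λ m → n ≤ m × seq m ≡ D
open Pattern public

_◁_ : Letter → Pattern → Pattern
seq (L ◁ P) zero = L
seq (L ◁ P) (suc n) = seq P n
infD (L ◁ P) zero with infD P zero
... | m , _ , e = suc m , z≤n , e
infD (L ◁ P) (suc n) with infD P n
... | m , le , e = suc m , s≤s le , e

DP : Pattern → Pattern
DP P = D ◁ P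

UP : Pattern → Pattern
UP P = U ◁ P

firstD : (ℕ → Letter) → (i fuel default : ℕ) → ℕ
firstD s i zero d = d
firstD s i (suc f) d with s i
... | D = i
... | U = firstD s (suc i) f d

nextD : Pattern → ℕ → ℕ
nextD P i with infD P i
... | m , _ , _ = firstD (seq P) i (suc (m ∸ i)) m

rotate : ∀ {A : Set} {n} → ℕ → Vec A (suc n) → Vec A (suc n)
rotate zero d = d
rotate (suc k) (x ∷ xs) = rotate k (xs ∷ʳ x)

-- deal a deck of (suc n) cards (listed top to bottom, entries = initial
-- positions), the next letter to process being at index i; returns the
-- initial position of the last card dealt.
deal : Pattern → (n : ℕ) → Vec ℕ (suc n) → ℕ → ℕ
deal P zero (x ∷ []) i = x
deal P (suc n) d i = deal P n (tail (rotate (nextD P i ∸ i) d)) (suc (nextD P i))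

F : Pattern → (N : ℕ) → .{{_ : Data.Nat.NonZero N}} → ℕ
F P (suc n) = deal P n (tabulate (λ k → suc (toℕ k))) 0

{-# OPTIONS --safe #-}
module Submission where

-- Dealing commutes with relabelling the cards, and dealing by L ◁ P from the
-- second letter on is dealing by P.  For DP the top card 1 is dealt at once
-- and the rest of the deck, 2 … N, is the deck 1 … N-1 relabelled by suc.
-- For UP the first U turns the deck 1 … N into 2 … N 1, which is the deck
-- relabelled by the cyclic successor x ↦ 1 + x mod N.

open import Defs
open import Data.Nat using (ℕ; zero; suc; _+_; _*_; _<_; _%_; _/_; _∸_; NonZero; s≤s; z≤n)
open import Data.Nat.Properties using (+-comm; +-suc; +-identityʳ; m<m+n; n∸n≡0)
open import Data.Nat.DivMod using (m≡m%n+[m/n]*n; [m+kn]%n≡m%n; m<n⇒m%n≡m; n%n≡0)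
open import Data.Fin using (toℕ)
open import Data.Product using (_×_; _,_; proj₁)
open import Data.Vec using (Vec; []; _∷_; _∷ʳ_; tail; map; tabulate; iterate)
open import Data.Vec.Properties using (map-∷ʳ; tabulate-∘; tabulate-cong)
open import Function using (_∘_)
open import Relation.Binary.PropositionalEquality
  using (_≡_; refl; sym; trans; cong; cong₂; subst; module ≡-Reasoning)
open ≡-Reasoning

firstD-◁ : ∀ L P i fuel d →
  firstD (seq (L ◁ P)) (suc i) fuel (suc d) ≡ suc (firstD (seq P) i fuel d)
firstD-◁ L P i zero    d = refl
firstD-◁ L P i (suc f) d with seq P i
... | D = refl
... | U = firstD-◁ L P (suc i) f d

nextD-◁ : ∀ L P i → nextD (L ◁ P) (suc i) ≡ suc (nextD P i)
nextD-◁ L P i = firstD-◁ L P i (suc (proj₁ (infD P i) ∸ i)) (proj₁ (infD P i))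

nextD-U◁ : ∀ P → nextD (U ◁ P) 0 ≡ suc (nextD P 0)
nextD-U◁ P = firstD-◁ U P 0 (suc (proj₁ (infD P 0))) (proj₁ (infD P 0))

nextD-at-D : ∀ P i → seq P i ≡ D → nextD P i ≡ i
nextD-at-D P i e with seq P i
... | D = refl

deal-◁ : ∀ L P n (d : Vec ℕ (suc n)) i → deal (L ◁ P) n d (suc i) ≡ deal P n d i
deal-◁ L P zero    (x ∷ []) i = refl
deal-◁ L P (suc n) d        i = begin
  deal (L ◁ P) n (tail (rotate (nextD (L ◁ P) (suc i) ∸ suc i) d)) (suc (nextD (L ◁ P) (suc i)))
    ≡⟨ cong (λ k → deal (L ◁ P) n (tail (rotate (k ∸ suc i) d)) (suc k)) (nextD-◁ L P i) ⟩
  deal (L ◁ P) n (tail (rotate (nextD P i ∸ i) d)) (suc (suc (nextD P i)))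
    ≡⟨ deal-◁ L P n _ _ ⟩
  deal P n (tail (rotate (nextD P i ∸ i) d)) (suc (nextD P i)) ∎

deal-at-D : ∀ P {i} → seq P i ≡ D → ∀ n x (d : Vec ℕ (suc n)) →
  deal P (suc n) (x ∷ d) i ≡ deal P n d (suc i)
deal-at-D P {i} e n x d rewrite nextD-at-D P i e | n∸n≡0 i = refl

deal-U◁ : ∀ P n (d : Vec ℕ (suc n)) → deal (U ◁ P) n d 0 ≡ deal P n (rotate 1 d) 0
deal-U◁ P zero    (x ∷ []) = refl
deal-U◁ P (suc n) (x ∷ d)  = begin
  deal (U ◁ P) n (tail (rotate (nextD (U ◁ P) 0) (x ∷ d))) (suc (nextD (U ◁ P) 0))
    ≡⟨ cong (λ k → deal (U ◁ P) n (tail (rotate k (x ∷ d))) (suc k)) (nextD-U◁ P) ⟩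
  deal (U ◁ P) n (tail (rotate (nextD P 0) (d ∷ʳ x))) (suc (suc (nextD P 0)))
    ≡⟨ deal-◁ U P n _ _ ⟩
  deal P n (tail (rotate (nextD P 0) (d ∷ʳ x))) (suc (nextD P 0)) ∎

map-tail : ∀ {n} (g : ℕ → ℕ) (v : Vec ℕ (suc n)) → tail (map g v) ≡ map g (tail v)
map-tail g (x ∷ v) = refl

rotate-map : ∀ {n} (g : ℕ → ℕ) k (v : Vec ℕ (suc n)) →
  rotate k (map g v) ≡ map g (rotate k v)
rotate-map g zero    v       = refl
rotate-map g (suc k) (x ∷ v) = begin
  rotate k (map g v ∷ʳ g x) ≡⟨ cong (rotate k) (map-∷ʳ g x v) ⟨
  rotate k (map g (v ∷ʳ x)) ≡⟨ rotate-map g k (v ∷ʳ x) ⟩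
  map g (rotate k (v ∷ʳ x)) ∎

deal-map : ∀ P n (g : ℕ → ℕ) (d : Vec ℕ (suc n)) i → deal P n (map g d) i ≡ g (deal P n d i)
deal-map P zero    g (x ∷ []) i = refl
deal-map P (suc n) g d        i = begin
  deal P n (tail (rotate k (map g d))) (suc (nextD P i))
    ≡⟨ cong (λ v → deal P n (tail v) (suc (nextD P i))) (rotate-map g k d) ⟩
  deal P n (tail (map g (rotate k d))) (suc (nextD P i))
    ≡⟨ cong (λ v → deal P n v (suc (nextD P i))) (map-tail g (rotate k d)) ⟩
  deal P n (map g (tail (rotate k d))) (suc (nextD P i))
    ≡⟨ deal-map P n g _ _ ⟩
  g (deal P n (tail (rotate k d)) (suc (nextD P i))) ∎
  where k = nextD P i ∸ i

tabulate-+-toℕ : ∀ a n → tabulate (λ k → a + toℕ k) ≡ iterate suc a n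
tabulate-+-toℕ a zero    = refl
tabulate-+-toℕ a (suc n) = cong₂ _∷_ (+-identityʳ a) (begin
  tabulate (λ k → a + suc (toℕ k)) ≡⟨ tabulate-cong (λ k → +-suc a (toℕ k)) ⟩
  tabulate (λ k → suc a + toℕ k)   ≡⟨ tabulate-+-toℕ (suc a) n ⟩
  iterate suc (suc a) n            ∎)

cyclicSuc : (N : ℕ) → .{{NonZero N}} → ℕ → ℕ
cyclicSuc N x = suc (x % N)

iterate-suc-∷ʳ-1 : ∀ N .{{_ : NonZero N}} m a → a + m ≡ N →
  iterate suc (suc a) m ∷ʳ 1 ≡ map (cyclicSuc N) (iterate suc a (suc m))
iterate-suc-∷ʳ-1 N zero    a a+0≡N = cong (λ y → suc y ∷ []) (begin
  0     ≡⟨ n%n≡0 N ⟨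
  N % N ≡⟨ cong (_% N) (trans (sym a+0≡N) (+-identityʳ a)) ⟩
  a % N ∎)
iterate-suc-∷ʳ-1 N (suc m) a a+sm≡N = cong₂ _∷_
  (cong suc (sym (m<n⇒m%n≡m (subst (a <_) a+sm≡N (m<m+n a (s≤s z≤n))))))
  (iterate-suc-∷ʳ-1 N m (suc a) (trans (sym (+-suc a m)) a+sm≡N))

deck : (N : ℕ) → Vec ℕ N
deck N = tabulate (suc ∘ toℕ)

rotate-deck : ∀ n → rotate 1 (deck (suc n)) ≡ map (cyclicSuc (suc n)) (deck (suc n))
rotate-deck n = begin
  rotate 1 (deck (suc n))
    ≡⟨ cong (rotate 1) (tabulate-+-toℕ 1 (suc n)) ⟩
  iterate suc 2 n ∷ʳ 1
    ≡⟨ iterate-suc-∷ʳ-1 (suc n) n 1 refl ⟩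
  map (cyclicSuc (suc n)) (iterate suc 1 (suc n))
    ≡⟨ cong (map (cyclicSuc (suc n))) (tabulate-+-toℕ 1 (suc n)) ⟨
  map (cyclicSuc (suc n)) (deck (suc n)) ∎

F-DP : ∀ P n → F (DP P) (suc (suc n)) ≡ suc (F P (suc n))
F-DP P n = begin
  deal (D ◁ P) (suc n) (1 ∷ tabulate (suc ∘ suc ∘ toℕ)) 0
    ≡⟨ deal-at-D (D ◁ P) refl n 1 _ ⟩
  deal (D ◁ P) n (tabulate (suc ∘ suc ∘ toℕ)) 1
    ≡⟨ deal-◁ D P n _ 0 ⟩
  deal P n (tabulate (suc ∘ suc ∘ toℕ)) 0
    ≡⟨ cong (λ d → deal P n d 0) (tabulate-∘ suc (suc ∘ toℕ)) ⟩
  deal P n (map suc (deck (suc n))) 0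
    ≡⟨ deal-map P n suc (deck (suc n)) 0 ⟩
  suc (F P (suc n)) ∎

F-UP : ∀ P n → F (UP P) (suc n) ≡ cyclicSuc (suc n) (F P (suc n))
F-UP P n = begin
  deal (U ◁ P) n (deck (suc n)) 0
    ≡⟨ deal-U◁ P n (deck (suc n)) ⟩
  deal P n (rotate 1 (deck (suc n))) 0
    ≡⟨ cong (λ d → deal P n d 0) (rotate-deck n) ⟩
  deal P n (map (cyclicSuc (suc n)) (deck (suc n))) 0
    ≡⟨ deal-map P n (cyclicSuc (suc n)) (deck (suc n)) 0 ⟩
  cyclicSuc (suc n) (F P (suc n)) ∎

cyclicSuc-% : ∀ N .{{_ : NonZero N}} x → cyclicSuc N x % N ≡ suc x % N
cyclicSuc-% N x = begin
  suc (x % N) % N                ≡⟨ [m+kn]%n≡m%n (suc (x % N)) (x / N) N ⟨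
  suc (x % N + x / N * N) % N    ≡⟨ cong (λ y → suc y % N) (m≡m%n+[m/n]*n x N) ⟨
  suc x % N                      ∎

mainTheorem9 : (P : Pattern) →
    (F (DP P) 1 ≡ 1)
    × (∀ (n : ℕ) → F (DP P) (suc (suc n)) ≡ F P (suc n) + 1)
    × (∀ (N : ℕ) → .{{_ : NonZero N}} → F (UP P) N % N ≡ (1 + F P N) % N)
mainTheorem9 P = refl , (λ n → trans (F-DP P n) (+-comm 1 _)) , F-UP-%
  where
  F-UP-% : ∀ (N : ℕ) → .{{_ : NonZero N}} → F (UP P) N % N ≡ (1 + F P N) % N
  F-UP-% (suc n) = trans (cong (_% suc n) (F-UP P n)) (cyclicSuc-% (suc n) (F P (suc n)))
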